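{- Let $\mathcal{P}=\langle P,\le\rangle$ be a finite bounded poset with $|P|\ge 2$ and height $h$. For $a\in P$ let $\tilde R(a)=[\tilde r_*(a),\ h-\tilde r^*(a)-1]$ and $R^+(a)=[h(\uparrow a)-1,\ h-h(\downarrow a)]$. Then $\tilde R=R^+$.
   Context: $\tilde r_*$ is defined recursively by $\tilde r_*(a)=0$ if $a$ is maximal in $P$, and $\tilde r_*(a)=k$ if $a$ is maximal in $P\setminus\{b\in P:\tilde r_*(b)<k\}$. Dually, $\tilde r^*(a)=0$ if $a$ is minimal in $P$, and $\tilde r^*(a)=k$ if $a$ is minimal in $P\setminus\{b\in P:\tilde r^*(b)<k\}$. The height $h(Q)$ of a subposet $Q$ is the number of elements in its largest chain, $h=h(P)$, $\uparrow a=\{b:b\ge a\}$, $\downarrow a=\{b:b\le a\}$. -}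

module Defs where

open import Level using (0ℓ)
open import Data.Nat using (ℕ; zero; suc; _∸_) renaming (_≤_ to _≤ℕ_)
open import Data.Fin using (Fin)
open import Data.List using (List; length)
open import Data.List.Relation.Unary.All using (All)
open import Data.List.Relation.Unary.AllPairs using (AllPairs)
open import Data.List.Relation.Unary.Unique.Propositional using (Unique)
open import Data.Product using (Σ; _×_; ∃)
open import Data.Sum using (_⊎_)
open import Data.Empty using (⊥)
open import Relation.Nullary using (¬_)
open import Relation.Binary using (Rel; Decidable; IsPartialOrder)
open import Relation.Binary.PropositionalEquality using (_≡_)

record FinPoset : Set₁ where
  field
    n     : ℕ
    _≤_   : Rel (Fin n) 0ℓ
    isPO  : IsPartialOrder _≡_ _≤_
    _≤?_  : Decidable _≤_

module _ (P : FinPoset) where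
  open FinPoset P

  Elt : Set
  Elt = Fin n

  Subset : Set₁
  Subset = Elt → Set

  Bounded : Set
  Bounded = (Σ Elt λ t → ∀ a → a ≤ t) × (Σ Elt λ b → ∀ a → b ≤ a)

  Comparable : Elt → Elt → Set
  Comparable a b = a ≤ b ⊎ b ≤ a

  IsChain : Subset → List Elt → Set
  IsChain Q xs = Unique xs × All Q xs × AllPairs Comparable xs

  IsHeight : Subset → ℕ → Set
  IsHeight Q m = (Σ (List Elt) λ xs → IsChain Q xs × length xs ≡ m)
               × (∀ xs → IsChain Q xs → length xs ≤ℕ m)

  Whole : Subset
  Whole _ = Elt

  Up : Elt → Subset
  Up a b = a ≤ b

  Down : Elt → Subset
  Down a b = b ≤ a

  IsMaximalIn : Subset → Elt → Set
  IsMaximalIn Q a = Q a × (∀ b → Q b → a ≤ b → b ≡ a)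

  IsMinimalIn : Subset → Elt → Set
  IsMinimalIn Q a = Q a × (∀ b → Q b → b ≤ a → b ≡ a)

  -- BelowLow k = { b : r̃_*(b) < k }, built by peeling maximal elements
  BelowLow : ℕ → Subset
  BelowLow zero    _ = ⊥
  BelowLow (suc k) a = BelowLow k a ⊎ IsMaximalIn (λ b → ¬ BelowLow k b) a

  RankLow : Elt → ℕ → Set
  RankLow a k = IsMaximalIn (λ b → ¬ BelowLow k b) a

  -- BelowUp k = { b : r̃^*(b) < k }, built by peeling minimal elements
  BelowUp : ℕ → Subset
  BelowUp zero    _ = ⊥
  BelowUp (suc k) a = BelowUp k a ⊎ IsMinimalIn (λ b → ¬ BelowUp k b) a

  RankUp : Elt → ℕ → Set
  RankUp a k = IsMinimalIn (λ b → ¬ BelowUp k b) a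

_∈[_,_] : ℕ → ℕ → ℕ → Set
m ∈[ lo , hi ] = lo ≤ℕ m × m ≤ℕ hi

-- BelowLow k = { b : r̃_*(b) < k } is an up-set whose layers { b : r̃_*(b) = j }
-- are antichains, so a chain meets each layer at most once: every chain inside
-- BelowLow k, hence every chain in ↑a when r̃_*(a) < k, has at most k elements.
-- Conversely, if r̃_*(b) ≥ k > 0 then b is not maximal outside BelowLow (k − 1), so
-- some d > b has r̃_*(d) ≥ k − 1; iterating climbs a chain of k + 1 elements in ↑b.
-- Thus r̃_*(a) = h(↑a) − 1, dually (in the opposite poset) r̃^*(a) = h(↓a) − 1, and
-- the two intervals have the same endpoints.
module Submission where

open import Defs
open import Data.Nat using (ℕ; _≤_; _∸_)
open import Data.Product using (Σ; _×_)
open import Function.Bundles using (_⇔_)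

open import Data.Nat using (zero; suc; z≤n; s≤s; _+_)
open import Data.Nat.Properties using (≤-trans; ≤-reflexive; 1+n≰n; ∸-+-assoc; +-comm)
open import Data.Fin using (_≟_)
open import Data.Fin.Properties using (all?; ¬∀⟶∃¬)
open import Data.List using (List; []; _∷_; length; filter)
open import Data.List.Properties using (filter-all)
open import Data.List.Relation.Unary.All as All using (All; []; _∷_)
import Data.List.Relation.Unary.All.Properties as All
open import Data.List.Relation.Unary.AllPairs as AllPairs using ([]; _∷_)
import Data.List.Relation.Unary.AllPairs.Properties as AllPairs
import Data.List.Relation.Unary.Unique.Propositional.Properties as Unique
open import Data.Product using (_,_; map₂)
open import Data.Sum using (inj₁; inj₂; swap)
open import Data.Empty using (⊥-elim)
open import Function using (_∘_)
open import Relation.Nullary using (¬_; yes; no)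
open import Relation.Nullary.Decidable using (_×-dec_; _⊎-dec_; _→-dec_; ¬?)
open import Relation.Unary using (Decidable)
open import Relation.Binary using (IsPartialOrder)
open import Relation.Binary.PropositionalEquality using (_≡_; _≢_; refl; sym; cong; subst; module ≡-Reasoning)
open import Function.Bundles using (mk⇔)

IsHeight-inhabited⇒pos : ∀ (P : FinPoset) {Q m} (a : Elt P) →
  IsHeight P Q m → Q a → 1 ≤ m
IsHeight-inhabited⇒pos P a (_ , bound) a∈Q = bound (a ∷ []) (([] ∷ []) , (a∈Q ∷ []) , ([] ∷ []))

module _ (P : FinPoset) where
  open FinPoset P renaming (_≤_ to _⊑_; _≤?_ to _⊑?_)
  open IsPartialOrder isPO using (antisym) renaming (refl to ⊑-refl; trans to ⊑-trans)

  BelowLow? : ∀ k → Decidable (BelowLow P k)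
  BelowLow? zero    a = no λ ()
  BelowLow? (suc k) a = BelowLow? k a ⊎-dec (¬? (BelowLow? k a) ×-dec
    all? λ b → ¬? (BelowLow? k b) →-dec (a ⊑? b →-dec b ≟ a))

  maximal-comparable⇒≡ : ∀ {Q x y} → IsMaximalIn P Q x → IsMaximalIn P Q y →
    Comparable P x y → x ≡ y
  maximal-comparable⇒≡ {x = x} {y} (_ , x-max) (y∈Q , _) (inj₁ x⊑y) = sym (x-max y y∈Q x⊑y)
  maximal-comparable⇒≡ {x = x} {y} (x∈Q , _) (_ , y-max) (inj₂ y⊑x) = y-max x x∈Q y⊑x

  BelowLow-suc⇒RankLow : ∀ k {x} → BelowLow P (suc k) x → ¬ BelowLow P k x → RankLow P x k
  BelowLow-suc⇒RankLow k (inj₁ x∈) x∉ = ⊥-elim (x∉ x∈)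
  BelowLow-suc⇒RankLow k (inj₂ x-top) _ = x-top

  BelowLow-upward : ∀ k {b c} → BelowLow P k b → b ⊑ c → BelowLow P k c
  BelowLow-upward (suc k) (inj₁ b∈) b⊑c = inj₁ (BelowLow-upward k b∈ b⊑c)
  BelowLow-upward (suc k) {c = c} b∈@(inj₂ (_ , b-max)) b⊑c with BelowLow? k c
  ... | yes c∈ = inj₁ c∈
  ... | no c∉  = subst (BelowLow P (suc k)) (sym (b-max c c∉ b⊑c)) b∈

  chain-length≤suc-filter : ∀ k {xs} → IsChain P (BelowLow P (suc k)) xs →
    length xs ≤ suc (length (filter (BelowLow? k) xs))
  chain-length≤suc-filter k {[]} _ = z≤n
  chain-length≤suc-filter k {x ∷ xs} (x∉xs ∷ uniq , x∈ ∷ xs∈ , x~xs ∷ comp) with BelowLow? k x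
  ... | yes _  = s≤s (chain-length≤suc-filter k (uniq , xs∈ , comp))
  ... | no x∉k = s≤s (≤-reflexive (cong length (sym (filter-all (BelowLow? k) xs∈k))))
    where
    below : ∀ {y} → x ≢ y × BelowLow P (suc k) y × Comparable P x y → BelowLow P k y
    below (_   , inj₁ y∈k , _)   = y∈k
    below (x≢y , inj₂ y-top , x~y) =
      ⊥-elim (x≢y (maximal-comparable⇒≡ (BelowLow-suc⇒RankLow k x∈ x∉k) y-top x~y))

    xs∈k : All (BelowLow P k) xs
    xs∈k = All.zipWith below (x∉xs , All.zip (xs∈ , x~xs))

  chain-in-BelowLow-length≤ : ∀ k {xs} → IsChain P (BelowLow P k) xs → length xs ≤ k
  chain-in-BelowLow-length≤ zero    {[]}    _             = z≤n
  chain-in-BelowLow-length≤ zero    {_ ∷ _} (_ , () ∷ _ , _)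
  chain-in-BelowLow-length≤ (suc k) {xs}    chain@(uniq , _ , comp) =
    ≤-trans (chain-length≤suc-filter k chain)
            (s≤s (chain-in-BelowLow-length≤ k
                    ( Unique.filter⁺ (BelowLow? k) uniq
                    , All.all-filter (BelowLow? k) xs
                    , AllPairs.filter⁺ (BelowLow? k) comp )))

  chain-above-BelowLow-length≤ : ∀ k {b xs} → BelowLow P k b → IsChain P (Up P b) xs →
    length xs ≤ k
  chain-above-BelowLow-length≤ k b∈ (uniq , above , comp) =
    chain-in-BelowLow-length≤ k (uniq , All.map (BelowLow-upward k b∈) above , comp)

  IsChain-Up-∷ : ∀ {a b xs} → a ⊑ b → a ≢ b → IsChain P (Up P b) xs →
    IsChain P (Up P a) (a ∷ xs)
  IsChain-Up-∷ {a} {b} a⊑b a≢b (uniq , above , comp) =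
      All.map (λ b⊑z a≡z → a≢b (antisym a⊑b (subst (b ⊑_) (sym a≡z) b⊑z))) above ∷ uniq
    , ⊑-refl ∷ All.map (⊑-trans a⊑b) above
    , All.map (inj₁ ∘ ⊑-trans a⊑b) above ∷ comp

  ∉BelowLow-suc⇒strictly-above : ∀ k {b} → ¬ BelowLow P (suc k) b →
    Σ (Elt P) λ d → ¬ BelowLow P k d × b ⊑ d × b ≢ d
  ∉BelowLow-suc⇒strictly-above k {b} b∉ with ¬∀⟶∃¬ n _ maximal-at? not-maximal
    where
    maximal-at? = λ d → ¬? (BelowLow? k d) →-dec (b ⊑? d →-dec d ≟ b)
    not-maximal = λ b-max → b∉ (inj₂ (b∉ ∘ inj₁ , b-max))
  ... | d , ¬maximal-at-d with BelowLow? k d | b ⊑? d | d ≟ b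
  ... | yes d∈ | _      | _      = ⊥-elim (¬maximal-at-d λ d∉ → ⊥-elim (d∉ d∈))
  ... | no _   | no b⋢d | _      = ⊥-elim (¬maximal-at-d λ _ b⊑d → ⊥-elim (b⋢d b⊑d))
  ... | no _   | yes _  | yes d≡b = ⊥-elim (¬maximal-at-d λ _ _ → d≡b)
  ... | no d∉  | yes b⊑d | no d≢b = d , d∉ , b⊑d , d≢b ∘ sym

  ∉BelowLow⇒long-chain-above : ∀ k {b} → ¬ BelowLow P k b →
    Σ (List (Elt P)) λ xs → IsChain P (Up P b) xs × length xs ≡ suc k
  ∉BelowLow⇒long-chain-above zero    {b} _ = b ∷ [] , (([] ∷ []) , (⊑-refl ∷ []) , ([] ∷ [])) , refl
  ∉BelowLow⇒long-chain-above (suc k) {b} b∉ with ∉BelowLow-suc⇒strictly-above k b∉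
  ... | d , d∉ , b⊑d , b≢d with ∉BelowLow⇒long-chain-above k d∉
  ... | xs , chain , len = b ∷ xs , IsChain-Up-∷ b⊑d b≢d chain , cong suc len

  height-Up⇒RankLow : ∀ {a m} → IsHeight P (Up P a) m → RankLow P a (m ∸ 1)
  height-Up⇒RankLow {a} {zero} height = ⊥-elim (1+n≰n (IsHeight-inhabited⇒pos P a height ⊑-refl))
  height-Up⇒RankLow {a} {suc k} ((xs , chain , len) , bound) = a∉ , a-max
    where
    a∉ : ¬ BelowLow P k a
    a∉ a∈ = 1+n≰n (subst (_≤ k) len (chain-above-BelowLow-length≤ k a∈ chain))

    a-max : ∀ b → ¬ BelowLow P k b → a ⊑ b → b ≡ a
    a-max b b∉ a⊑b with b ≟ a
    ... | yes b≡a = b≡a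
    ... | no b≢a with ∉BelowLow⇒long-chain-above k b∉
    ... | ys , chain′ , len′ = ⊥-elim (1+n≰n (subst (λ l → suc l ≤ suc k) len′
            (bound (a ∷ ys) (IsChain-Up-∷ a⊑b (b≢a ∘ sym) chain′))))

opposite : FinPoset → FinPoset
opposite P = record
  { n    = n
  ; _≤_  = λ a b → b ⊑ a
  ; _≤?_ = λ a b → b ⊑? a
  ; isPO = record
    { isPreorder = record
      { isEquivalence = isEquivalence
      ; reflexive     = reflexive ∘ sym
      ; trans         = λ p q → trans q p
      }
    ; antisym = λ p q → antisym q p
    }
  }
  where open FinPoset P renaming (_≤_ to _⊑_; _≤?_ to _⊑?_)
        open IsPartialOrder isPO

module _ (P : FinPoset) where
  BelowUp⇒BelowLow-opposite : ∀ k {a} → BelowUp P k a → BelowLow (opposite P) k a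
  BelowLow-opposite⇒BelowUp : ∀ k {a} → BelowLow (opposite P) k a → BelowUp P k a

  BelowUp⇒BelowLow-opposite (suc k) (inj₁ a∈) = inj₁ (BelowUp⇒BelowLow-opposite k a∈)
  BelowUp⇒BelowLow-opposite (suc k) (inj₂ (a∉ , a-min)) =
    inj₂ (a∉ ∘ BelowLow-opposite⇒BelowUp k , λ b b∉ → a-min b (b∉ ∘ BelowUp⇒BelowLow-opposite k))
  BelowLow-opposite⇒BelowUp (suc k) (inj₁ a∈) = inj₁ (BelowLow-opposite⇒BelowUp k a∈)
  BelowLow-opposite⇒BelowUp (suc k) (inj₂ (a∉ , a-max)) =
    inj₂ (a∉ ∘ BelowUp⇒BelowLow-opposite k , λ b b∉ → a-max b (b∉ ∘ BelowLow-opposite⇒BelowUp k))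

  RankLow-opposite⇒RankUp : ∀ {a k} → RankLow (opposite P) a k → RankUp P a k
  RankLow-opposite⇒RankUp {k = k} (a∉ , a-max) =
    a∉ ∘ BelowUp⇒BelowLow-opposite k , λ b b∉ → a-max b (b∉ ∘ BelowLow-opposite⇒BelowUp k)

  height-Down⇒height-Up-opposite : ∀ {a m} → IsHeight P (Down P a) m →
    IsHeight (opposite P) (Up (opposite P) a) m
  height-Down⇒height-Up-opposite ((xs , (uniq , below , comp) , len) , bound) =
      (xs , (uniq , below , AllPairs.map swap comp) , len)
    , λ ys (uniq′ , below′ , comp′) → bound ys (uniq′ , below′ , AllPairs.map swap comp′)

  height-Down⇒RankUp : ∀ {a m} → IsHeight P (Down P a) m → RankUp P a (m ∸ 1)
  height-Down⇒RankUp = RankLow-opposite⇒RankUp ∘ height-Up⇒RankLow (opposite P)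
                     ∘ height-Down⇒height-Up-opposite

∸-∸1-∸1 : ∀ m n → 1 ≤ n → m ∸ (n ∸ 1) ∸ 1 ≡ m ∸ n
∸-∸1-∸1 m (suc j) _ = begin
  m ∸ j ∸ 1     ≡⟨ ∸-+-assoc m j 1 ⟩
  m ∸ (j + 1)   ≡⟨ cong (m ∸_) (+-comm j 1) ⟩
  m ∸ suc j     ∎
  where open ≡-Reasoning

corollary2 : (P : FinPoset) → Bounded P → 2 ≤ FinPoset.n P →
    (h : ℕ) → IsHeight P (Whole P) h →
    (a : Elt P) → (hu hd : ℕ) → IsHeight P (Up P a) hu → IsHeight P (Down P a) hd →
    Σ ℕ λ rl → Σ ℕ λ ru → RankLow P a rl × RankUp P a ru ×
    (∀ m → (m ∈[ rl , h ∸ ru ∸ 1 ]) ⇔ (m ∈[ hu ∸ 1 , h ∸ hd ]))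
corollary2 P _ _ h _ a hu hd height-up height-down =
    hu ∸ 1 , hd ∸ 1 , height-Up⇒RankLow P height-up , height-Down⇒RankUp P height-down
  , λ m → mk⇔ (map₂ (subst (m ≤_) upper-endpoint)) (map₂ (subst (m ≤_) (sym upper-endpoint)))
  where
  upper-endpoint : h ∸ (hd ∸ 1) ∸ 1 ≡ h ∸ hd
  upper-endpoint = ∸-∸1-∸1 h hd (IsHeight-inhabited⇒pos P a height-down
                     (IsPartialOrder.refl (FinPoset.isPO P)))
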